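{- For every formula $A\in\mathsf{Form}_Q$, $\vdash_{i3} A\leftrightarrow f(A)$, where $f$ is the reduction map and $\vdash_{i3}$ is derivability in $\mathbf{QBDi3}$.
   Context: $\mathcal{L}_Q$: first-order language with $\bot,{\sim},\land,\lor,\to,\forall,\exists$, countably many constants, variables and predicate symbols; $\mathsf{Form}_Q$ its formulas; $\neg A:=A\to\bot$, $A\leftrightarrow B:=(A\to B)\land(B\to A)$. $\mathbf{QBDi3}$ is the Hilbert system with axioms (Ax1) $A\to(B\to A)$; (Ax2) $(A\to(B\to C))\to((A\to B)\to(A\to C))$; (Ax4) $(A\land B)\to A$; (Ax5) $(A\land B)\to B$; (Ax6) $(C\to A)\to((C\to B)\to(C\to(A\land B)))$; (Ax7) $A\to(A\lor B)$; (Ax8) $B\to(A\lor B)$; (Ax9) $(A\to C)\to((B\to C)\to((A\lor B)\to C))$; (Ax10) $\bot\to A$; (Ax11) $A(t)\to\exists xA$; (Ax12) $\forall x(A(x)\to B)\to(\exists xA(x)\to B)$ ($x$ not free in $B$); (Ax13) $\forall x(B\to A)\to(B\to\forall xA)$ ($x$ not free in $B$); (Ax14) $\forall xA\to A(t)$; (Ax15) $A\to{\sim}\bot$; (Ax16) ${\sim}{\sim}A\leftrightarrow A$; (Ax17) ${\sim}(A\land B)\leftrightarrow({\sim}A\lor{\sim}B)$; (Ax18) ${\sim}(A\lor B)\leftrightarrow({\sim}A\land{\sim}B)$; (Ax19) ${\sim}(A\to B)\leftrightarrow(\neg{\sim}A\land{\sim}B)$; (Ax20) ${\sim}\forall xA\leftrightarrow\exists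 x{\sim}A$; (Ax21) ${\sim}\exists xA\leftrightarrow\forall x{\sim}A$; (i1) $\forall x\neg\neg A\to\neg\neg\forall xA$; (i2) ${\sim}A\to\neg A$; (i3) $\neg\neg(A\lor{\sim}A)$; and rules MP (from $A$, $A\to B$ infer $B$) and Gen (from $A$ infer $\forall xA$). $\Gamma\vdash_{i3}A$: there is a finite list ending in $A$ each item of which is in $\Gamma$, an axiom instance, or follows from earlier items by MP or Gen. The reduction $f:\mathsf{Form}_Q\to\mathsf{Form}_Q$: $f(P)=P$ and $f({\sim}P)={\sim}P$ for atomic $P$; $f(\bot)=\bot$, $f({\sim}\bot)={\sim}\bot$; $f(A\circ B)=f(A)\circ f(B)$ for $\circ\in\{\land,\lor,\to\}$; $f(QxA)=Qxf(A)$ for $Q\in\{\forall,\exists\}$; $f({\sim}{\sim}A)=f(A)$; $f({\sim}(A\land B))=f({\sim}A)\lor f({\sim}B)$; $f({\sim}(A\lor B))=f({\sim}A)\land f({\sim}B)$; $f({\sim}(A\to B))=\neg f({\sim}A)\land f({\sim}B)$; $f({\sim}\forall xA)=\exists xf({\sim}A)$; $f({\sim}\exists xA)=\forall xf({\sim}A)$. -}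

module Defs where

open import Data.Nat using (ℕ; _≟_)
open import Data.Vec using (Vec; []; _∷_)
open import Data.Product using (_×_)
open import Data.Sum using (_⊎_)
open import Data.Empty using (⊥)
open import Data.Unit using (⊤)
open import Relation.Nullary using (¬_; yes; no)
open import Relation.Binary.PropositionalEquality using (_≡_)

data Term : Set where
  var   : ℕ → Term
  const : ℕ → Term

-- Formulas of L_Q. Predicate symbols: countably many of each arity n
-- (atom n p ts is the p-th n-ary predicate applied to ts).
infix 4 _⇔_
infixr 5 _⇒_
infix 9 ∼_
infix 9 ¬'_
infixr 6 _∨'_
infixr 7 _∧'_
data Form : Set where
  atom  : (n p : ℕ) → Vec Term n → Form
  ⊥'    : Form
  ∼_    : Form → Form
  _∧'_  : Form → Form → Form
  _∨'_  : Form → Form → Form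
  _⇒_   : Form → Form → Form
  ∀'    : ℕ → Form → Form
  ∃'    : ℕ → Form → Form

¬'_ : Form → Form
¬' A = A ⇒ ⊥'

_⇔_ : Form → Form → Form
A ⇔ B = (A ⇒ B) ∧' (B ⇒ A)

occT : ℕ → Term → Set
occT x (var y)   = x ≡ y
occT x (const c) = ⊥

occV : ∀ {n} → ℕ → Vec Term n → Set
occV x []       = ⊥
occV x (t ∷ ts) = occT x t ⊎ occV x ts

FreeIn : ℕ → Form → Set
FreeIn x (atom n p ts) = occV x ts
FreeIn x ⊥'            = ⊥
FreeIn x (∼ A)         = FreeIn x A
FreeIn x (A ∧' B)      = FreeIn x A ⊎ FreeIn x B
FreeIn x (A ∨' B)      = FreeIn x A ⊎ FreeIn x B
FreeIn x (A ⇒ B)       = FreeIn x A ⊎ FreeIn x B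
FreeIn x (∀' y A)      = ¬ (x ≡ y) × FreeIn x A
FreeIn x (∃' y A)      = ¬ (x ≡ y) × FreeIn x A

substT : ℕ → Term → Term → Term
substT x t (var y) with x ≟ y
... | yes _ = t
... | no  _ = var y
substT x t (const c) = const c

substV : ∀ {n} → ℕ → Term → Vec Term n → Vec Term n
substV x t []       = []
substV x t (s ∷ ss) = substT x t s ∷ substV x t ss

subst : ℕ → Term → Form → Form
subst x t (atom n p ts) = atom n p (substV x t ts)
subst x t ⊥'            = ⊥'
subst x t (∼ A)         = ∼ subst x t A
subst x t (A ∧' B)      = subst x t A ∧' subst x t B
subst x t (A ∨' B)      = subst x t A ∨' subst x t B
subst x t (A ⇒ B)       = subst x t A ⇒ subst x t B
subst x t (∀' y A) with x ≟ y
... | yes _ = ∀' y A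
... | no  _ = ∀' y (subst x t A)
subst x t (∃' y A) with x ≟ y
... | yes _ = ∃' y A
... | no  _ = ∃' y (subst x t A)

FreeFor : Term → ℕ → Form → Set
FreeFor t x (atom n p ts) = ⊤
FreeFor t x ⊥'            = ⊤
FreeFor t x (∼ A)         = FreeFor t x A
FreeFor t x (A ∧' B)      = FreeFor t x A × FreeFor t x B
FreeFor t x (A ∨' B)      = FreeFor t x A × FreeFor t x B
FreeFor t x (A ⇒ B)       = FreeFor t x A × FreeFor t x B
FreeFor t x (∀' y A)      = FreeIn x (∀' y A) → (¬ occT y t × FreeFor t x A)
FreeFor t x (∃' y A)      = FreeIn x (∃' y A) → (¬ occT y t × FreeFor t x A)

-- Derivability in QBDi3 from a set of premises Γ (derivation trees,
-- equivalent to the finite-list definition).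
infix 3 _⊢i3_
data _⊢i3_ (Γ : Form → Set) : Form → Set where
  hyp  : ∀ {A} → Γ A → Γ ⊢i3 A
  ax1  : ∀ A B → Γ ⊢i3 A ⇒ (B ⇒ A)
  ax2  : ∀ A B C → Γ ⊢i3 (A ⇒ (B ⇒ C)) ⇒ ((A ⇒ B) ⇒ (A ⇒ C))
  ax4  : ∀ A B → Γ ⊢i3 (A ∧' B) ⇒ A
  ax5  : ∀ A B → Γ ⊢i3 (A ∧' B) ⇒ B
  ax6  : ∀ A B C → Γ ⊢i3 (C ⇒ A) ⇒ ((C ⇒ B) ⇒ (C ⇒ (A ∧' B)))
  ax7  : ∀ A B → Γ ⊢i3 A ⇒ (A ∨' B)
  ax8  : ∀ A B → Γ ⊢i3 B ⇒ (A ∨' B)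
  ax9  : ∀ A B C → Γ ⊢i3 (A ⇒ C) ⇒ ((B ⇒ C) ⇒ ((A ∨' B) ⇒ C))
  ax10 : ∀ A → Γ ⊢i3 ⊥' ⇒ A
  ax11 : ∀ x A t → FreeFor t x A → Γ ⊢i3 subst x t A ⇒ ∃' x A
  ax12 : ∀ x A B → ¬ FreeIn x B → Γ ⊢i3 ∀' x (A ⇒ B) ⇒ (∃' x A ⇒ B)
  ax13 : ∀ x A B → ¬ FreeIn x B → Γ ⊢i3 ∀' x (B ⇒ A) ⇒ (B ⇒ ∀' x A)
  ax14 : ∀ x A t → FreeFor t x A → Γ ⊢i3 ∀' x A ⇒ subst x t A
  ax15 : ∀ A → Γ ⊢i3 A ⇒ ∼ ⊥'
  ax16 : ∀ A → Γ ⊢i3 (∼ ∼ A) ⇔ A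
  ax17 : ∀ A B → Γ ⊢i3 ∼ (A ∧' B) ⇔ (∼ A ∨' ∼ B)
  ax18 : ∀ A B → Γ ⊢i3 ∼ (A ∨' B) ⇔ (∼ A ∧' ∼ B)
  ax19 : ∀ A B → Γ ⊢i3 ∼ (A ⇒ B) ⇔ ((¬' (∼ A)) ∧' ∼ B)
  ax20 : ∀ x A → Γ ⊢i3 ∼ (∀' x A) ⇔ ∃' x (∼ A)
  ax21 : ∀ x A → Γ ⊢i3 ∼ (∃' x A) ⇔ ∀' x (∼ A)
  i1   : ∀ x A → Γ ⊢i3 ∀' x (¬' ¬' A) ⇒ ¬' ¬' (∀' x A)
  i2   : ∀ A → Γ ⊢i3 ∼ A ⇒ ¬' A
  i3   : ∀ A → Γ ⊢i3 ¬' ¬' (A ∨' ∼ A)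
  mp   : ∀ {A B} → Γ ⊢i3 A → Γ ⊢i3 A ⇒ B → Γ ⊢i3 B
  gen  : ∀ {A} x → Γ ⊢i3 A → Γ ⊢i3 ∀' x A

∅ : Form → Set
∅ _ = ⊥

-- The reduction f. Agda needs f(∼A) as a mutually defined function fn A
-- (fn A stands for f(∼A)); the clauses are exactly those of the paper.
mutual
  f : Form → Form
  f (atom n p ts) = atom n p ts
  f ⊥'            = ⊥'
  f (∼ A)         = fn A
  f (A ∧' B)      = f A ∧' f B
  f (A ∨' B)      = f A ∨' f B
  f (A ⇒ B)       = f A ⇒ f B
  f (∀' x A)      = ∀' x (f A)
  f (∃' x A)      = ∃' x (f A)

  fn : Form → Form
  fn (atom n p ts) = ∼ atom n p ts
  fn ⊥'            = ∼ ⊥'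
  fn (∼ A)         = f A
  fn (A ∧' B)      = fn A ∨' fn B
  fn (A ∨' B)      = fn A ∧' fn B
  fn (A ⇒ B)       = (¬' fn A) ∧' fn B
  fn (∀' x A)      = ∃' x (fn A)
  fn (∃' x A)      = ∀' x (fn A)

module Submission where

open import Defs
open import Data.Nat using (_≟_)
open import Data.Vec using (Vec; []; _∷_)
open import Data.Product using (_×_; _,_)
open import Data.Unit using (tt)
open import Relation.Nullary using (¬_; yes; no)
open import Relation.Binary.PropositionalEquality as ≡ using (_≡_; refl; cong; cong₂)

-- By simultaneous induction on A one proves A ↔ f(A) and ∼A ↔ f(∼A).
-- Each ∼-clause of f is one of the De Morgan axioms Ax16–Ax21 read from
-- left to right, so it remains to know that provable equivalence is a
-- congruence for ∧, ∨, →, ∀ and ∃; for the quantifiers this follows from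
-- Gen, Ax12 and Ax13 together with the trivial instances x := x of Ax11
-- and Ax14.

substT-id : ∀ x s → substT x (var x) s ≡ s
substT-id x (var y) with x ≟ y
... | yes x≡y = cong var x≡y
... | no  _   = refl
substT-id x (const c) = refl

substV-id : ∀ {n} x (ts : Vec Term n) → substV x (var x) ts ≡ ts
substV-id x []       = refl
substV-id x (t ∷ ts) = cong₂ _∷_ (substT-id x t) (substV-id x ts)

subst-id : ∀ x A → subst x (var x) A ≡ A
subst-id x (atom n p ts) = cong (atom n p) (substV-id x ts)
subst-id x ⊥'            = refl
subst-id x (∼ A)         = cong ∼_ (subst-id x A)
subst-id x (A ∧' B)      = cong₂ _∧'_ (subst-id x A) (subst-id x B)
subst-id x (A ∨' B)      = cong₂ _∨'_ (subst-id x A) (subst-id x B)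
subst-id x (A ⇒ B)       = cong₂ _⇒_ (subst-id x A) (subst-id x B)
subst-id x (∀' y A) with x ≟ y
... | yes _ = refl
... | no  _ = cong (∀' y) (subst-id x A)
subst-id x (∃' y A) with x ≟ y
... | yes _ = refl
... | no  _ = cong (∃' y) (subst-id x A)

var-freeFor-self : ∀ x A → FreeFor (var x) x A
var-freeFor-self x (atom n p ts) = tt
var-freeFor-self x ⊥'            = tt
var-freeFor-self x (∼ A)         = var-freeFor-self x A
var-freeFor-self x (A ∧' B)      = var-freeFor-self x A , var-freeFor-self x B
var-freeFor-self x (A ∨' B)      = var-freeFor-self x A , var-freeFor-self x B
var-freeFor-self x (A ⇒ B)       = var-freeFor-self x A , var-freeFor-self x B
var-freeFor-self x (∀' y A) (x≢y , _) = (λ y≡x → x≢y (≡.sym y≡x)) , var-freeFor-self x A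
var-freeFor-self x (∃' y A) (x≢y , _) = (λ y≡x → x≢y (≡.sym y≡x)) , var-freeFor-self x A

∀-not-free : ∀ x A → ¬ FreeIn x (∀' x A)
∀-not-free x A (x≢x , _) = x≢x refl

∃-not-free : ∀ x A → ¬ FreeIn x (∃' x A)
∃-not-free x A (x≢x , _) = x≢x refl

module Derivable (Γ : Form → Set) where

  infix 3 ⊢_ _⊣⊢_

  ⊢_ : Form → Set
  ⊢ A = Γ ⊢i3 A

  _⊣⊢_ : Form → Form → Set
  A ⊣⊢ B = (⊢ A ⇒ B) × (⊢ B ⇒ A)

  ⇒-refl : ∀ A → ⊢ A ⇒ A
  ⇒-refl A = mp (ax1 A A) (mp (ax1 A (A ⇒ A)) (ax2 A (A ⇒ A) A))

  ⇒-const : ∀ {A} X → ⊢ A → ⊢ X ⇒ A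
  ⇒-const {A} X ⊢A = mp ⊢A (ax1 A X)

  mp-under : ∀ {X A B} → ⊢ X ⇒ A → ⊢ X ⇒ (A ⇒ B) → ⊢ X ⇒ B
  mp-under {X} {A} {B} ⊢A ⊢A⇒B = mp ⊢A (mp ⊢A⇒B (ax2 X A B))

  ⇒-trans : ∀ {A B C} → ⊢ A ⇒ B → ⊢ B ⇒ C → ⊢ A ⇒ C
  ⇒-trans {A} A⇒B B⇒C = mp-under A⇒B (⇒-const A B⇒C)

  ⇒-trans-under : ∀ {X A B C} → ⊢ X ⇒ (A ⇒ B) → ⊢ X ⇒ (B ⇒ C) → ⊢ X ⇒ (A ⇒ C)
  ⇒-trans-under {X} {A} {B} {C} A⇒B B⇒C =
    mp-under A⇒B (⇒-trans (⇒-trans B⇒C (ax1 (B ⇒ C) A)) (ax2 A B C))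

  ∧-intro : ∀ {A B} → ⊢ A → ⊢ B → ⊢ A ∧' B
  ∧-intro {A} {B} ⊢A ⊢B = mp ⊢A (mp (⇒-const A ⊢B) (mp (⇒-refl A) (ax6 A B A)))

  ∀-elim : ∀ x A → ⊢ ∀' x A ⇒ A
  ∀-elim x A = ≡.subst (λ B → ⊢ ∀' x A ⇒ B) (subst-id x A) (ax14 x A (var x) (var-freeFor-self x A))

  ∃-intro : ∀ x A → ⊢ A ⇒ ∃' x A
  ∃-intro x A = ≡.subst (λ B → ⊢ B ⇒ ∃' x A) (subst-id x A) (ax11 x A (var x) (var-freeFor-self x A))

  ∧-mono : ∀ {A A′ B B′} → ⊢ A ⇒ A′ → ⊢ B ⇒ B′ → ⊢ (A ∧' B) ⇒ (A′ ∧' B′)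
  ∧-mono {A} {A′} {B} {B′} A⇒A′ B⇒B′ =
    mp (⇒-trans (ax5 A B) B⇒B′) (mp (⇒-trans (ax4 A B) A⇒A′) (ax6 A′ B′ (A ∧' B)))

  ∨-mono : ∀ {A A′ B B′} → ⊢ A ⇒ A′ → ⊢ B ⇒ B′ → ⊢ (A ∨' B) ⇒ (A′ ∨' B′)
  ∨-mono {A} {A′} {B} {B′} A⇒A′ B⇒B′ =
    mp (⇒-trans B⇒B′ (ax8 A′ B′)) (mp (⇒-trans A⇒A′ (ax7 A′ B′)) (ax9 A B (A′ ∨' B′)))

  ⇒-mono : ∀ {A A′ B B′} → ⊢ A′ ⇒ A → ⊢ B ⇒ B′ → ⊢ (A ⇒ B) ⇒ (A′ ⇒ B′)
  ⇒-mono {A} {A′} {B} {B′} A′⇒A B⇒B′ =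
    ⇒-trans-under (⇒-trans-under (⇒-const (A ⇒ B) A′⇒A) (⇒-refl (A ⇒ B))) (⇒-const (A ⇒ B) B⇒B′)

  ∀-mono : ∀ {A B} x → ⊢ A ⇒ B → ⊢ ∀' x A ⇒ ∀' x B
  ∀-mono {A} {B} x A⇒B = mp (gen x (⇒-trans (∀-elim x A) A⇒B)) (ax13 x B (∀' x A) (∀-not-free x A))

  ∃-mono : ∀ {A B} x → ⊢ A ⇒ B → ⊢ ∃' x A ⇒ ∃' x B
  ∃-mono {A} {B} x A⇒B = mp (gen x (⇒-trans A⇒B (∃-intro x B))) (ax12 x A (∃' x B) (∃-not-free x B))

  ⊣⊢-refl : ∀ A → A ⊣⊢ A
  ⊣⊢-refl A = ⇒-refl A , ⇒-refl A

  ⊣⊢-trans : ∀ {A B C} → A ⊣⊢ B → B ⊣⊢ C → A ⊣⊢ C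
  ⊣⊢-trans (A⇒B , B⇒A) (B⇒C , C⇒B) = ⇒-trans A⇒B B⇒C , ⇒-trans C⇒B B⇒A

  ⇔⇒⊣⊢ : ∀ {A B} → ⊢ A ⇔ B → A ⊣⊢ B
  ⇔⇒⊣⊢ ⊢A⇔B = mp ⊢A⇔B (ax4 _ _) , mp ⊢A⇔B (ax5 _ _)

  ⊣⊢⇒⇔ : ∀ {A B} → A ⊣⊢ B → ⊢ A ⇔ B
  ⊣⊢⇒⇔ (A⇒B , B⇒A) = ∧-intro A⇒B B⇒A

  ∧-cong : ∀ {A A′ B B′} → A ⊣⊢ A′ → B ⊣⊢ B′ → A ∧' B ⊣⊢ A′ ∧' B′
  ∧-cong (A⇒A′ , A′⇒A) (B⇒B′ , B′⇒B) = ∧-mono A⇒A′ B⇒B′ , ∧-mono A′⇒A B′⇒B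

  ∨-cong : ∀ {A A′ B B′} → A ⊣⊢ A′ → B ⊣⊢ B′ → A ∨' B ⊣⊢ A′ ∨' B′
  ∨-cong (A⇒A′ , A′⇒A) (B⇒B′ , B′⇒B) = ∨-mono A⇒A′ B⇒B′ , ∨-mono A′⇒A B′⇒B

  ⇒-cong : ∀ {A A′ B B′} → A ⊣⊢ A′ → B ⊣⊢ B′ → (A ⇒ B) ⊣⊢ (A′ ⇒ B′)
  ⇒-cong (A⇒A′ , A′⇒A) (B⇒B′ , B′⇒B) = ⇒-mono A′⇒A B⇒B′ , ⇒-mono A⇒A′ B′⇒B

  ¬-cong : ∀ {A A′} → A ⊣⊢ A′ → ¬' A ⊣⊢ ¬' A′
  ¬-cong A⊣⊢A′ = ⇒-cong A⊣⊢A′ (⊣⊢-refl ⊥')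

  ∀-cong : ∀ {A B} x → A ⊣⊢ B → ∀' x A ⊣⊢ ∀' x B
  ∀-cong x (A⇒B , B⇒A) = ∀-mono x A⇒B , ∀-mono x B⇒A

  ∃-cong : ∀ {A B} x → A ⊣⊢ B → ∃' x A ⊣⊢ ∃' x B
  ∃-cong x (A⇒B , B⇒A) = ∃-mono x A⇒B , ∃-mono x B⇒A

  mutual
    ⊣⊢-f : ∀ A → A ⊣⊢ f A
    ⊣⊢-f (atom n p ts) = ⊣⊢-refl _
    ⊣⊢-f ⊥'            = ⊣⊢-refl _
    ⊣⊢-f (∼ A)         = ⊣⊢-fn A
    ⊣⊢-f (A ∧' B)      = ∧-cong (⊣⊢-f A) (⊣⊢-f B)
    ⊣⊢-f (A ∨' B)      = ∨-cong (⊣⊢-f A) (⊣⊢-f B)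
    ⊣⊢-f (A ⇒ B)       = ⇒-cong (⊣⊢-f A) (⊣⊢-f B)
    ⊣⊢-f (∀' x A)      = ∀-cong x (⊣⊢-f A)
    ⊣⊢-f (∃' x A)      = ∃-cong x (⊣⊢-f A)

    ⊣⊢-fn : ∀ A → ∼ A ⊣⊢ fn A
    ⊣⊢-fn (atom n p ts) = ⊣⊢-refl _
    ⊣⊢-fn ⊥'            = ⊣⊢-refl _
    ⊣⊢-fn (∼ A)         = ⊣⊢-trans (⇔⇒⊣⊢ (ax16 A)) (⊣⊢-f A)
    ⊣⊢-fn (A ∧' B)      = ⊣⊢-trans (⇔⇒⊣⊢ (ax17 A B)) (∨-cong (⊣⊢-fn A) (⊣⊢-fn B))
    ⊣⊢-fn (A ∨' B)      = ⊣⊢-trans (⇔⇒⊣⊢ (ax18 A B)) (∧-cong (⊣⊢-fn A) (⊣⊢-fn B))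
    ⊣⊢-fn (A ⇒ B)       = ⊣⊢-trans (⇔⇒⊣⊢ (ax19 A B)) (∧-cong (¬-cong (⊣⊢-fn A)) (⊣⊢-fn B))
    ⊣⊢-fn (∀' x A)      = ⊣⊢-trans (⇔⇒⊣⊢ (ax20 x A)) (∃-cong x (⊣⊢-fn A))
    ⊣⊢-fn (∃' x A)      = ⊣⊢-trans (⇔⇒⊣⊢ (ax21 x A)) (∀-cong x (⊣⊢-fn A))

proposition3p4 : (A : Form) → ∅ ⊢i3 A ⇔ f A
proposition3p4 A = ⊣⊢⇒⇔ (⊣⊢-f A)
  where open Derivable ∅
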